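{- For a Frobenius array $\mu \in \mathcal{F}(\beta)$, the array $\gamma$ is an $S_{\beta}$-partition, i.e., the entries of $\gamma$ in each row are (weakly) decreasing and the entries in each column are (weakly) decreasing. In addition, the entries in each column of $\gamma$ that came from a positive block of $\mu$ are strictly decreasing.
   Context: A partition $\lambda$ with $d$ diagonal dots is written as a Frobenius symbol, a two-rowed array $\begin{pmatrix} x_1 & \cdots & x_d \\ y_1 & \cdots & y_d\end{pmatrix}$ with $x_1>\cdots>x_d\ge 0$ and $y_1>\cdots>y_d\ge 0$. A column $\begin{smallmatrix} x_i\\ y_i\end{smallmatrix}$ is positive if $x_i-y_i\ge 1$ and negative if $x_i-y_i\le 0$. Parity blocks are maximal sets of contiguous columns all of the same parity (positive or negative). Subtracting $d-1, d-2,\ldots,1,0$ from the entries of columns $1,2,\ldots,d$ (in both rows) gives a two-rowed array $\mu$ with weakly decreasing rows and the same column parities; $\mu$ is called a Frobenius array. For a composition $\beta=(b_1,\ldots,b_m)$ of $d$, let $r_i=b_1+\cdots+b_i$ ($r_0=0$). Let $\mathcal{F}(\beta)$ be the set of Frobenius arrays $\mu$ with $d$ columns and $m$ parity blocks $B_1,\ldots,B_m$, where $B_m$ is positive and $B_i$ has $b_i$ columns. Let $S_\beta=\bigcup_{l=1}^{m}\{(i,j): l\le i\le l+1,\ r_{l-1}+1\le j\le r_l\}$, ordered by $(i_1,j_1)\le(i_2,j_2)$ iff $i_1\le i_2$ and $j_1\le j_2$. An $S_\beta$-partition (w.r.t. its natural labeling) is a map $\pi:S_\beta\to\mathbb{N}$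 that is order-reversing: $x\le y$ implies $\pi(x)\ge\pi(y)$. Given $\mu\in\mathcal{F}(\beta)$, form $\hat\mu$ by interchanging the top and bottom entries of every column in each negative block of $\mu$. Then $\gamma$ is obtained by placing the $(i,j)$-th entry of $\hat\mu$ ($i=1$ top row, $i=2$ bottom row) at position $(i+l,j)$ of $S_\beta$, where $r_l<j\le r_{l+1}$. -}

module Defs where

open import Data.Nat using (ℕ; zero; suc; _+_; _∸_; _≤_; _<_)
open import Data.List using (List; length; take)
open import Data.Nat.ListAction using (sum)
open import Data.List.Relation.Unary.All using (All)
open import Data.Product using (Σ; _×_)
open import Data.Sum using (_⊎_)
open import Relation.Binary.PropositionalEquality using (_≡_)

-- Conventions: all row/column/block indices are 1-based, as in the paper.
-- Columns are indexed by j ∈ {1,…,d}; rows of a two-rowed array by 1 (top), 2 (bottom).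

IsComposition : List ℕ → Set
IsComposition β = All (λ b → 1 ≤ b) β

r : List ℕ → ℕ → ℕ
r β i = sum (take i β)

InBlock : List ℕ → ℕ → ℕ → Set
InBlock β l j = (1 ≤ l) × (l ≤ length β) × (suc (r β (l ∸ 1)) ≤ j) × (j ≤ r β l)

-- a two-rowed array of naturals; only columns 1..d are meaningful
record TwoRow : Set where
  field
    top : ℕ → ℕ
    bot : ℕ → ℕ
open TwoRow public

Positive : TwoRow → ℕ → Set
Positive μ j = suc (bot μ j) ≤ top μ j

Negative : TwoRow → ℕ → Set
Negative μ j = top μ j ≤ bot μ j

SameParity : TwoRow → ℕ → ℕ → Set
SameParity μ j k = (Positive μ j × Positive μ k) ⊎ (Negative μ j × Negative μ k)

OppositeParity : TwoRow → ℕ → ℕ → Set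
OppositeParity μ j k = (Positive μ j × Negative μ k) ⊎ (Negative μ j × Positive μ k)

FrobeniusSymbol : ℕ → TwoRow → Set
FrobeniusSymbol d λ′ = ∀ i j → 1 ≤ i → i < j → j ≤ d →
  (top λ′ j < top λ′ i) × (bot λ′ j < bot λ′ i)

FrobeniusArray : ℕ → TwoRow → Set
FrobeniusArray d μ = Σ TwoRow λ λ′ → FrobeniusSymbol d λ′ ×
  (∀ j → 1 ≤ j → j ≤ d → (top λ′ j ≡ top μ j + (d ∸ j)) × (bot λ′ j ≡ bot μ j + (d ∸ j)))

PositiveBlock : List ℕ → TwoRow → ℕ → Set
PositiveBlock β μ l = ∀ j → InBlock β l j → Positive μ j

NegativeBlock : List ℕ → TwoRow → ℕ → Set
NegativeBlock β μ l = ∀ j → InBlock β l j → Negative μ j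

-- μ ∈ 𝓕(β): a Frobenius array with d = sum β columns whose parity blocks
-- (maximal contiguous same-parity runs) are exactly B₁,…,Bₘ of sizes b₁,…,bₘ, with Bₘ positive.
InF : List ℕ → TwoRow → Set
InF β μ =
  FrobeniusArray (sum β) μ ×
  (∀ l j k → InBlock β l j → InBlock β l k → SameParity μ j k) ×
  (∀ l j k → InBlock β l j → InBlock β (suc l) k → OppositeParity μ j k) ×
  PositiveBlock β μ (length β)

InS : List ℕ → ℕ → ℕ → Set
InS β i j = Σ ℕ λ l → InBlock β l j × (l ≤ i) × (i ≤ suc l)

-- γ is obtained from μ: μ̂ swaps top/bottom in negative blocks, and the entry of μ̂
-- in row 1 (resp. 2), column j ∈ B_l is placed at position (l, j) (resp. (l+1, j)).
-- γ is a map (row, column) ↦ ℕ; only its values on S_β matter.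
IsGamma : List ℕ → TwoRow → (ℕ → ℕ → ℕ) → Set
IsGamma β μ γ = ∀ l j → InBlock β l j →
  (PositiveBlock β μ l → (γ l j ≡ top μ j) × (γ (suc l) j ≡ bot μ j)) ×
  (NegativeBlock β μ l → (γ l j ≡ bot μ j) × (γ (suc l) j ≡ top μ j))

-- S_β-partition w.r.t. the natural labeling: order-reversing map S_β → ℕ
SPartition : List ℕ → (ℕ → ℕ → ℕ) → Set
SPartition β γ = ∀ i₁ j₁ i₂ j₂ → InS β i₁ j₁ → InS β i₂ j₂ →
  i₁ ≤ i₂ → j₁ ≤ j₂ → γ i₂ j₂ ≤ γ i₁ j₁

module Submission where

-- In each column j of μ let colMax j and colMin j be the larger
-- and the smaller of its two entries.  Forming μ̂ swaps exactly the negative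
-- columns, so μ̂ always carries the larger entry on top; hence in block l the
-- entries of γ are colMax j in row l and colMin j in row l+1.  The theorem then
-- rests on three facts:
--   * a Frobenius array has weakly decreasing rows (undo the shift by d - j of
--     the strictly decreasing Frobenius symbol), so colMax and colMin are
--     antitone in j;
--   * at a block boundary the adjacent columns r_l, r_l + 1 have opposite
--     parity, which forces colMax (r_l + 1) ≤ colMin r_l; combined with
--     antitonicity, every entry of a later block is below every entry of an
--     earlier one;
--   * in a positive column the top entry exceeds the bottom one (strictness).

open import Defs
open import Data.Nat using (ℕ; zero; suc; _<_; _≤_; _+_; _∸_; _⊔_; _⊓_; z≤n; s≤s; s≤s⁻¹)
open import Data.Nat.Properties
open import Data.Nat.ListAction using (sum)
open import Data.List using (List; []; _∷_; length)
open import Data.List.Relation.Unary.All using (_∷_)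
open import Data.Product using (_×_; _,_; proj₁; proj₂)
open import Data.Sum using (_⊎_; inj₁; inj₂)
open import Relation.Binary.PropositionalEquality
open import Relation.Nullary using (contradiction)
open ≤-Reasoning

r≤sum : ∀ β l → r β l ≤ sum β
r≤sum β        zero    = z≤n
r≤sum []       (suc l) = z≤n
r≤sum (b ∷ β) (suc l) = +-monoʳ-≤ b (r≤sum β l)

r-mono : ∀ β {l l′} → l ≤ l′ → r β l ≤ r β l′
r-mono β        {zero}            _         = z≤n
r-mono []       {suc l}           _         = z≤n
r-mono (b ∷ β) {suc l} {suc l′} (s≤s l≤l′) = +-monoʳ-≤ b (r-mono β l≤l′)

r-strict : ∀ β l → IsComposition β → l < length β → r β l < r β (suc l)
r-strict (b ∷ β) zero    (1≤b ∷ _) _         = ≤-trans 1≤b (m≤m+n b 0)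
r-strict (b ∷ β) (suc l) (_ ∷ comp) (s≤s l<m) = +-monoʳ-< b (r-strict β l comp l<m)

inBlock-range : ∀ {β l j} → InBlock β l j → 1 ≤ j × j ≤ sum β
inBlock-range {β} {l} (_ , _ , r<j , j≤r) = ≤-trans (s≤s z≤n) r<j , ≤-trans j≤r (r≤sum β l)

last-column : ∀ {β l j} → InBlock β l j → InBlock β l (r β l)
last-column (1≤l , l≤m , r<j , j≤r) = 1≤l , l≤m , ≤-trans r<j j≤r , ≤-refl

first-column : ∀ β l → IsComposition β → suc l ≤ length β → InBlock β (suc l) (suc (r β l))
first-column β l comp l<m = s≤s z≤n , l<m , ≤-refl , r-strict β l comp l<m

antitone-from-steps : ∀ d (f : ℕ → ℕ) → (∀ j → 1 ≤ j → suc j ≤ d → f (suc j) ≤ f j) →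
  ∀ {j k} → 1 ≤ j → j ≤ k → k ≤ d → f k ≤ f j
antitone-from-steps d f step {suc j} {suc k} 1≤j j≤k k≤d with m≤n⇒m<n∨m≡n j≤k
... | inj₂ refl       = ≤-refl
... | inj₁ (s≤s j≤k′) =
  ≤-trans (step k (≤-trans 1≤j j≤k′) k≤d)
          (antitone-from-steps d f step 1≤j j≤k′ (≤-trans (n≤1+n k) k≤d))

WeaklyDecreasingRows : ℕ → TwoRow → Set
WeaklyDecreasingRows d μ = ∀ j → 1 ≤ j → suc j ≤ d →
  top μ (suc j) ≤ top μ j × bot μ (suc j) ≤ bot μ j

-- Undoing the shift: if g j = f j + (d - j) drops strictly from j to j+1,
-- then f drops weakly (the shift itself accounts for a drop of exactly one).
unshift-step : ∀ d (f g : ℕ → ℕ) j → suc j ≤ d →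
  g j ≡ f j + (d ∸ j) → g (suc j) ≡ f (suc j) + (d ∸ suc j) →
  g (suc j) < g j → f (suc j) ≤ f j
unshift-step d f g j j<d gj gj′ drop = +-cancelʳ-≤ c (f (suc j)) (f j) (s≤s⁻¹ (begin-strict
  f (suc j) + c       ≡⟨ sym gj′ ⟩
  g (suc j)           <⟨ drop ⟩
  g j                 ≡⟨ gj ⟩
  f j + (d ∸ j)       ≡⟨ cong (f j +_) (+-∸-assoc 1 j<d) ⟩
  f j + suc c         ≡⟨ +-suc (f j) c ⟩
  suc (f j + c)       ∎))
  where
  c : ℕ
  c = d ∸ suc j

frobenius-rows : ∀ {d μ} → FrobeniusArray d μ → WeaklyDecreasingRows d μ
frobenius-rows {d} {μ} (λ′ , symbol , shift) j 1≤j j<d =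
  unshift-step d (top μ) (top λ′) j j<d (proj₁ here) (proj₁ next) (proj₁ drop) ,
  unshift-step d (bot μ) (bot λ′) j j<d (proj₂ here) (proj₂ next) (proj₂ drop)
  where
  here : top λ′ j ≡ top μ j + (d ∸ j) × bot λ′ j ≡ bot μ j + (d ∸ j)
  here = shift j 1≤j (≤-trans (n≤1+n j) j<d)
  next : top λ′ (suc j) ≡ top μ (suc j) + (d ∸ suc j) × bot λ′ (suc j) ≡ bot μ (suc j) + (d ∸ suc j)
  next = shift (suc j) (s≤s z≤n) j<d
  drop : top λ′ (suc j) < top λ′ j × bot λ′ (suc j) < bot λ′ j
  drop = symbol j (suc j) 1≤j ≤-refl j<d

colMax colMin : TwoRow → ℕ → ℕ
colMax μ j = top μ j ⊔ bot μ j
colMin μ j = top μ j ⊓ bot μ j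

positive-extremes : ∀ {x y} → y < x → x ⊔ y ≡ x × x ⊓ y ≡ y
positive-extremes y<x = m≥n⇒m⊔n≡m (<⇒≤ y<x) , m≥n⇒m⊓n≡n (<⇒≤ y<x)

negative-extremes : ∀ {x y} → x ≤ y → x ⊔ y ≡ y × x ⊓ y ≡ x
negative-extremes x≤y = m≤n⇒m⊔n≡n x≤y , m≤n⇒m⊓n≡m x≤y

colMax-antitone : ∀ {d μ} → WeaklyDecreasingRows d μ →
  ∀ {j k} → 1 ≤ j → j ≤ k → k ≤ d → colMax μ k ≤ colMax μ j
colMax-antitone {d} {μ} rows = antitone-from-steps d (colMax μ)
  (λ j 1≤j j<d → ⊔-mono-≤ (proj₁ (rows j 1≤j j<d)) (proj₂ (rows j 1≤j j<d)))

colMin-antitone : ∀ {d μ} → WeaklyDecreasingRows d μ →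
  ∀ {j k} → 1 ≤ j → j ≤ k → k ≤ d → colMin μ k ≤ colMin μ j
colMin-antitone {d} {μ} rows = antitone-from-steps d (colMin μ)
  (λ j 1≤j j<d → ⊓-mono-≤ (proj₁ (rows j 1≤j j<d)) (proj₂ (rows j 1≤j j<d)))

opposite-parity-below : ∀ {x y x′ y′} → x′ ≤ x → y′ ≤ y →
  (y < x × x′ ≤ y′) ⊎ (x ≤ y × y′ < x′) → x′ ⊔ y′ ≤ x ⊓ y
opposite-parity-below x′≤x y′≤y (inj₁ (y<x , x′≤y′)) =
  subst₂ _≤_ (sym (proj₁ (negative-extremes x′≤y′))) (sym (proj₂ (positive-extremes y<x))) y′≤y
opposite-parity-below x′≤x y′≤y (inj₂ (x≤y , y′<x′)) =
  subst₂ _≤_ (sym (proj₁ (positive-extremes y′<x′))) (sym (proj₂ (negative-extremes x≤y))) x′≤x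

-- Since a column cannot be both positive and negative, the parity of any one
-- column of a block of μ ∈ 𝓕(β) is the parity of the whole block.
block-parity : ∀ {β μ l j} → InF β μ → InBlock β l j →
  PositiveBlock β μ l ⊎ NegativeBlock β μ l
block-parity {β} {μ} {l} {j} (_ , same , _) j∈l with same l j j j∈l j∈l
... | inj₁ (pos , _) = inj₁ λ k k∈l → positive (same l j k j∈l k∈l)
  where
  positive : ∀ {k} → SameParity μ j k → Positive μ k
  positive (inj₁ (_ , pos-k)) = pos-k
  positive (inj₂ (neg , _))   = contradiction neg (<⇒≱ pos)
... | inj₂ (neg , _) = inj₂ λ k k∈l → negative (same l j k j∈l k∈l)
  where
  negative : ∀ {k} → SameParity μ j k → Negative μ k
  negative (inj₁ (pos , _))   = contradiction neg (<⇒≱ pos)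
  negative (inj₂ (_ , neg-k)) = neg-k

gamma-extremes : ∀ {β μ γ l j} → InF β μ → IsGamma β μ γ → InBlock β l j →
  γ l j ≡ colMax μ j × γ (suc l) j ≡ colMin μ j
gamma-extremes {l = l} {j} inF isγ j∈l with block-parity inF j∈l
... | inj₁ pos = let (up , down) = proj₁ (isγ l j j∈l) pos
                     (max , min) = positive-extremes (pos j j∈l) in
  trans up (sym max) , trans down (sym min)
... | inj₂ neg = let (up , down) = proj₂ (isγ l j j∈l) neg
                     (max , min) = negative-extremes (neg j j∈l) in
  trans up (sym max) , trans down (sym min)

-- Every entry of a later block of μ is below every entry of an earlier block:
-- move right to the boundary r_l | r_l + 1, cross it by opposite parity, and
-- move right again.
later-block-below : ∀ {β μ l l′ j k} → IsComposition β → InF β μ →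
  InBlock β l j → InBlock β l′ k → l < l′ → colMax μ k ≤ colMin μ j
later-block-below {β} {μ} {l} {suc m} {j} {k} comp (frob , _ , opposite , _)
  j∈l k∈l′@(_ , l′≤len , r<k , _) (s≤s l≤m) = begin
  colMax μ k  ≤⟨ colMax-antitone rows (proj₁ (inBlock-range q∈)) q≤k (proj₂ (inBlock-range k∈l′)) ⟩
  colMax μ q  ≤⟨ opposite-parity-below (proj₁ boundary) (proj₂ boundary) (opposite l p q p∈ q∈) ⟩
  colMin μ p  ≤⟨ colMin-antitone rows (proj₁ (inBlock-range j∈l)) j≤p (proj₂ (inBlock-range p∈)) ⟩
  colMin μ j  ∎
  where
  rows : WeaklyDecreasingRows (sum β) μ
  rows = frobenius-rows frob
  p q : ℕ
  p = r β l
  q = suc p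
  p∈ : InBlock β l p
  p∈ = last-column j∈l
  q∈ : InBlock β (suc l) q
  q∈ = first-column β l comp (≤-trans (s≤s l≤m) l′≤len)
  j≤p : j ≤ p
  j≤p = proj₂ (proj₂ (proj₂ j∈l))
  q≤k : q ≤ k
  q≤k = ≤-trans (s≤s (r-mono β l≤m)) r<k
  boundary : top μ q ≤ top μ p × bot μ q ≤ bot μ p
  boundary = rows p (proj₁ (inBlock-range p∈)) (proj₂ (inBlock-range q∈))

upper-or-lower : ∀ {l i} → l ≤ i → i ≤ suc l → i ≡ l ⊎ i ≡ suc l
upper-or-lower l≤i i≤l+1 with m≤n⇒m<n∨m≡n i≤l+1
... | inj₁ (s≤s i≤l) = inj₁ (≤-antisym i≤l l≤i)
... | inj₂ i≡l+1     = inj₂ i≡l+1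

colMin≤gamma : ∀ {β μ γ i j} → InF β μ → IsGamma β μ γ → InS β i j → colMin μ j ≤ γ i j
colMin≤gamma {μ = μ} {γ} {j = j} inF isγ (l , j∈l , l≤i , i≤) with upper-or-lower l≤i i≤
... | inj₁ refl = subst (colMin μ j ≤_) (sym (proj₁ (gamma-extremes inF isγ j∈l))) (m⊓n≤m⊔n _ _)
... | inj₂ refl = ≤-reflexive (sym (proj₂ (gamma-extremes inF isγ j∈l)))

-- If (i₂, j₂) is in a lower row it holds
-- colMin j₂ ≤ colMin j₁ ≤ γ i₁ j₁.  Otherwise it holds colMax j₂, and either
-- (i₁, j₁) is an upper row too (compare colMax) or it is a lower row
-- l₁ + 1 ≤ l₂, so j₂ lies in a later block.
gamma-order-reversing : ∀ {β μ γ} → IsComposition β → InF β μ → IsGamma β μ γ →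
  SPartition β γ
gamma-order-reversing {μ = μ} {γ} comp inF@(frob , _) isγ i₁ j₁ i₂ j₂
  ij₁@(l₁ , j₁∈ , l₁≤i₁ , i₁≤) (l₂ , j₂∈ , l₂≤i₂ , i₂≤) i₁≤i₂ j₁≤j₂
  with upper-or-lower l₂≤i₂ i₂≤
... | inj₂ refl = begin
  γ (suc l₂) j₂  ≡⟨ proj₂ (gamma-extremes inF isγ j₂∈) ⟩
  colMin μ j₂    ≤⟨ colMin-antitone (frobenius-rows frob)
                   (proj₁ (inBlock-range j₁∈)) j₁≤j₂ (proj₂ (inBlock-range j₂∈)) ⟩
  colMin μ j₁    ≤⟨ colMin≤gamma inF isγ ij₁ ⟩
  γ i₁ j₁        ∎
... | inj₁ refl with upper-or-lower l₁≤i₁ i₁≤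
...   | inj₁ refl = begin
  γ l₂ j₂        ≡⟨ proj₁ (gamma-extremes inF isγ j₂∈) ⟩
  colMax μ j₂    ≤⟨ colMax-antitone (frobenius-rows frob)
                   (proj₁ (inBlock-range j₁∈)) j₁≤j₂ (proj₂ (inBlock-range j₂∈)) ⟩
  colMax μ j₁    ≡⟨ proj₁ (gamma-extremes inF isγ j₁∈) ⟨
  γ l₁ j₁        ∎
...   | inj₂ refl = begin
  γ l₂ j₂        ≡⟨ proj₁ (gamma-extremes inF isγ j₂∈) ⟩
  colMax μ j₂    ≤⟨ later-block-below comp inF j₁∈ j₂∈ i₁≤i₂ ⟩
  colMin μ j₁    ≡⟨ proj₂ (gamma-extremes inF isγ j₁∈) ⟨
  γ (suc l₁) j₁  ∎

positive-block-strict : ∀ {β μ γ} → IsGamma β μ γ →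
  ∀ l j → InBlock β l j → PositiveBlock β μ l → γ (suc l) j < γ l j
positive-block-strict {μ = μ} {γ} isγ l j j∈l pos =
  subst₂ _<_ (sym (proj₂ placed)) (sym (proj₁ placed)) (pos j j∈l)
  where
  placed : γ l j ≡ top μ j × γ (suc l) j ≡ bot μ j
  placed = proj₁ (isγ l j j∈l) pos

lemma4p2 : (β : List ℕ) (μ : TwoRow) (γ : ℕ → ℕ → ℕ) →
    IsComposition β → InF β μ → IsGamma β μ γ →
    SPartition β γ ×
    (∀ l j → InBlock β l j → PositiveBlock β μ l → γ (suc l) j < γ l j)
lemma4p2 β μ γ comp inF isγ =
  gamma-order-reversing comp inF isγ , positive-block-strict isγ
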